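{- Let $q$ be a prime power, let $d$ be an integer with $2<d<q-1$, and let $f=x^d\in\mathbb{F}_q[x]$. Then $\deg(S_f)\le\min(d,q-d+1)$. More specifically, for $a,b\in\mathbb{F}_q$, the number of $x\in\mathbb{F}_q$ with $x^d=ax+b$ is at most (i) $q-d+1$ if $a\neq0$ and $b=0$; (ii) $q-d$ if $a\neq 0$ and $b\neq 0$; (iii) $q-d-1$ if $a=0$ and $b\neq 0$.
   Context: $\mathrm{PG}(2,q)$ is the projective plane over $\mathbb{F}_q$. For $f\in\mathbb{F}_q[x]$, $S_f=\{(x,f(x),1):x\in\mathbb{F}_q\}\cup\{(0,1,0)\}$. For a set $D$ of $q+1$ points, $u_i(D)$ is the number of lines of $\mathrm{PG}(2,q)$ containing exactly $i$ points of $D$, and the degree $\deg(D)$ is the largest $i$ with $u_i(D)\neq 0$. -}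

module Defs where

open import Level using (0ℓ)
open import Algebra.Bundles using (CommutativeRing)
open import Data.Nat using (ℕ; zero; suc; _+_; _≤_)
open import Data.Fin using (Fin)
open import Relation.Binary.PropositionalEquality using (_≡_)
open import Data.Bool using (Bool; true; false; if_then_else_)
open import Data.Product using (Σ; _×_; ∃)
open import Relation.Nullary using (¬_; Dec)
open import Relation.Nullary.Decidable using (⌊_⌋)

record FiniteField (q : ℕ) : Set₁ where
  field
    commRing : CommutativeRing 0ℓ 0ℓ
  open CommutativeRing commRing public
  field
    0≉1      : ¬ (0# ≈ 1#)
    inverse  : ∀ x → ¬ (x ≈ 0#) → Σ Carrier (λ y → (x * y) ≈ 1#)
    _≟_      : ∀ x y → Dec (x ≈ y)
    elem     : Fin q → Carrier
    elem-inj : ∀ i j → elem i ≈ elem j → i ≡ j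
    elem-sur : ∀ x → ∃ (λ i → elem i ≈ x)

count : (n : ℕ) → (Fin n → Bool) → ℕ
count zero    p = 0
count (suc n) p = (if p Fin.zero then 1 else 0) + count n (λ i → p (Fin.suc i))

module _ {q : ℕ} (F : FiniteField q) where
  open FiniteField F renaming (_+_ to _+F_; _*_ to _*F_)

  pow : Carrier → ℕ → Carrier
  pow x zero    = 1#
  pow x (suc n) = x *F pow x n

  #solutions : ℕ → Carrier → Carrier → ℕ
  #solutions d a b = count q (λ i → ⌊ pow (elem i) d ≟ ((a *F elem i) +F b) ⌋)

  -- A line of PG(2,q) is given by a nonzero coordinate vector (l0,l1,l2),
  -- the line {(X,Y,Z) : l0 X + l1 Y + l2 Z = 0}.
  NonZeroVec : Carrier → Carrier → Carrier → Set
  NonZeroVec l0 l1 l2 = ¬ ((l0 ≈ 0#) × (l1 ≈ 0#) × (l2 ≈ 0#))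

  -- |ℓ ∩ S_f| for f = x^d, S_f = {(x, f x, 1)} ∪ {(0,1,0)}:
  -- the affine points (x, x^d, 1) (pairwise distinct) lying on ℓ,
  -- plus 1 if (0,1,0) lies on ℓ (i.e. l1 = 0).
  lineMeetsSf : ℕ → Carrier → Carrier → Carrier → ℕ
  lineMeetsSf d l0 l1 l2 =
    count q (λ i → ⌊ (((l0 *F elem i) +F (l1 *F pow (elem i) d)) +F l2) ≟ 0# ⌋)
    + (if ⌊ l1 ≟ 0# ⌋ then 1 else 0)

  -- deg(S_f) ≤ m : the largest i with u_i(S_f) ≠ 0 is at most m, i.e.
  -- every line of PG(2,q) contains at most m points of S_f.
  degSf≤ : ℕ → ℕ → Set
  degSf≤ d m = ∀ l0 l1 l2 → NonZeroVec l0 l1 l2 → lineMeetsSf d l0 l1 l2 ≤ m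

  IsZero : Carrier → Set
  IsZero x = x ≈ 0#

{-# OPTIONS --safe #-}
-- A line l0 X + l1 Y + l2 Z = 0 meets S_f in the roots of l0 x + l1 x^d + l2, plus the point
-- (0,1,0) when l1 = 0; if l1 = 0 that is at most 2 points, otherwise at most d. Let m = q - 1 - d.
-- As x^(q-1) = 1 for x ≠ 0, multiplying by x^m turns every nonzero root into a root of
-- l0 x^(m+1) + l2 x^m + l1, which has at most m + 1 = q - d roots (at most m if l0 = 0);
-- x = 0 adds at most one more root, and none if l2 ≠ 0. The equation x^d = a x + b is the line
-- (-a, 1, -b). Fermat's little theorem comes from comparing the product of the nonzero elements
-- with the product of their multiples by x; the root bound comes from the factor theorem.
module Submission where

open import Defs
open import Data.Nat using (ℕ; _<_; _≤_; _∸_; _+_; _⊓_)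
open import Data.Product using (_×_)
open import Relation.Nullary using (¬_)

open import Data.Nat using (zero; suc; z≤n; s≤s; _≤′_; ≤′-reflexive; ≤′-step)
open import Data.Nat.Properties
  using (+-mono-≤; ≤-trans; ≤-reflexive; ≤-refl; <⇒≤; <-trans; ≤⇒≤′; n<1+n; m≤n+m; +-suc; ⊓-glb)
import Data.Nat.Properties as ℕₚ
open import Data.Bool using (Bool; true; false; if_then_else_; T)
open import Data.Unit using (tt)
open import Data.Empty using (⊥-elim)
open import Data.Fin using (Fin; zero; suc; punchIn)
open import Data.Fin.Properties using (suc-injective; any?; punchInᵢ≢i)
open import Data.Fin.Permutation
  using (Permutation′; permutation; remove; _⟨$⟩ʳ_; insert-punchIn; insert-remove)
open import Data.Product using (Σ; _,_; proj₁; proj₂)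
open import Data.Sum using (_⊎_; inj₁; inj₂; map₁)
open import Function using (_∘_)
open import Relation.Binary.PropositionalEquality as ≡ using (_≡_)
open import Relation.Nullary using (yes; no)
open import Relation.Nullary.Decidable using (⌊_⌋; toWitness; fromWitness)

indicator-mono : ∀ {b c : Bool} → (T b → T c) → (if b then 1 else 0) ≤ (if c then 1 else 0)
indicator-mono {false}         _   = z≤n
indicator-mono {true}  {true}  _   = s≤s z≤n
indicator-mono {true}  {false} b⇒c = ⊥-elim (b⇒c tt)

indicator-≤1 : ∀ b → (if b then 1 else 0) ≤ 1
indicator-≤1 false = z≤n
indicator-≤1 true  = s≤s z≤n

count-mono : ∀ n {p r : Fin n → Bool} → (∀ i → T (p i) → T (r i)) → count n p ≤ count n r
count-mono zero    _   = z≤n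
count-mono (suc n) p⇒r = +-mono-≤ (indicator-mono (p⇒r zero)) (count-mono n (p⇒r ∘ suc))

count-none : ∀ n {p : Fin n → Bool} → (∀ i → ¬ T (p i)) → count n p ≡ 0
count-none zero    _    = ≡.refl
count-none (suc n) {p} ¬p with p zero | ¬p zero
... | false | _   = count-none n (¬p ∘ suc)
... | true  | ¬p0 = ⊥-elim (¬p0 tt)

count-≤-suc : ∀ n {p r : Fin n → Bool} (j : Fin n) → (∀ i → T (p i) → i ≡ j ⊎ T (r i)) →
              count n p ≤ suc (count n r)
count-≤-suc (suc n) {p} {r} zero p⇒j∨r =
  +-mono-≤ (indicator-≤1 (p zero)) (≤-trans (count-mono n p⇒r′) (m≤n+m _ _))
  where
  p⇒r′ : ∀ i → T (p (suc i)) → T (r (suc i))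
  p⇒r′ i pi with p⇒j∨r (suc i) pi
  ... | inj₂ ri = ri
count-≤-suc (suc n) {p} {r} (suc j) p⇒j∨r =
  ≤-trans (+-mono-≤ (indicator-mono p⇒r₀) (count-≤-suc n j (λ i → map₁ suc-injective ∘ p⇒j∨r (suc i))))
    (≤-reflexive (+-suc _ _))
  where
  p⇒r₀ : T (p zero) → T (r zero)
  p⇒r₀ p0 with p⇒j∨r zero p0
  ... | inj₂ r0 = r0

punchIn-remove : ∀ {n} (π : Permutation′ (suc n)) i j →
                 π ⟨$⟩ʳ punchIn i j ≡ punchIn (π ⟨$⟩ʳ i) (remove i π ⟨$⟩ʳ j)
punchIn-remove π i j =
  ≡.trans (≡.sym (insert-remove i π (punchIn i j))) (insert-punchIn i (π ⟨$⟩ʳ i) (remove i π) j)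

module FieldProperties {q : ℕ} (F : FiniteField q) where
  open FiniteField F renaming (_+_ to _+F_) hiding (zero)
  open import Algebra.Properties.Ring ring using (-0#≈0#; -‿injective)
  open import Relation.Binary.Reasoning.Setoid setoid

  index : Carrier → Fin q
  index y = proj₁ (elem-sur y)

  elem-index : ∀ y → elem (index y) ≈ y
  elem-index y = proj₂ (elem-sur y)

  *-cancelʳ : ∀ {h} x y → h ≉ 0# → x * h ≈ y * h → x ≈ y
  *-cancelʳ {h} x y h≉0 xh≈yh with inverse h h≉0
  ... | h⁻¹ , hh⁻¹≈1 = begin
    x              ≈⟨ *-identityʳ x ⟨
    x * 1#         ≈⟨ *-congˡ hh⁻¹≈1 ⟨
    x * (h * h⁻¹)  ≈⟨ *-assoc x h h⁻¹ ⟨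
    (x * h) * h⁻¹  ≈⟨ *-congʳ xh≈yh ⟩
    (y * h) * h⁻¹  ≈⟨ *-assoc y h h⁻¹ ⟩
    y * (h * h⁻¹)  ≈⟨ *-congˡ hh⁻¹≈1 ⟩
    y * 1#         ≈⟨ *-identityʳ y ⟩
    y              ∎

  *-≈0⇒≈0 : ∀ {x y} → y ≉ 0# → x * y ≈ 0# → x ≈ 0#
  *-≈0⇒≈0 {x} {y} y≉0 xy≈0 = *-cancelʳ x 0# y≉0 (trans xy≈0 (sym (zeroˡ y)))

  *-≉0 : ∀ {x y} → x ≉ 0# → y ≉ 0# → x * y ≉ 0#
  *-≉0 x≉0 y≉0 xy≈0 = x≉0 (*-≈0⇒≈0 y≉0 xy≈0)

  1≉0 : 1# ≉ 0#
  1≉0 1≈0 = 0≉1 (sym 1≈0)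

  -‿≈0 : ∀ {x} → x ≈ 0# → - x ≈ 0#
  -‿≈0 x≈0 = trans (-‿cong x≈0) -0#≈0#

  -‿≉0 : ∀ {x} → x ≉ 0# → - x ≉ 0#
  -‿≉0 x≉0 -x≈0 = x≉0 (-‿injective (trans -x≈0 (sym -0#≈0#)))

  pow-+ : ∀ x a b → pow F x (a + b) ≈ pow F x a * pow F x b
  pow-+ x zero    b = sym (*-identityˡ _)
  pow-+ x (suc a) b = trans (*-congˡ (pow-+ x a b)) (sym (*-assoc x _ _))

  pow-≈0 : ∀ {x} k → 0 < k → x ≈ 0# → pow F x k ≈ 0#
  pow-≈0 (suc k) _ x≈0 = trans (*-congʳ x≈0) (zeroˡ _)

  drop-zero-termˡ : ∀ {a x y} → a ≈ 0# → a * x +F y ≈ y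
  drop-zero-termˡ {a} {x} {y} a≈0 = trans (+-congʳ (trans (*-congʳ a≈0) (zeroˡ x))) (+-identityˡ y)

  drop-zero-termʳ : ∀ {a x y} → a ≈ 0# → y +F a * x ≈ y
  drop-zero-termʳ {a} {x} {y} a≈0 = trans (+-congˡ (trans (*-congʳ a≈0) (zeroˡ x))) (+-identityʳ y)

module PolynomialFunctions {q : ℕ} (F : FiniteField q) where
  open FiniteField F renaming (_+_ to _+F_) hiding (zero)
  open FieldProperties F
  open import Relation.Binary.Reasoning.Setoid setoid
  open import Algebra.Solver.Ring.NaturalCoefficients.Default commutativeSemiring
    using (solve; _:=_; _:+_; _:*_; con)

  roots : (Carrier → Carrier) → ℕ
  roots f = count q (λ i → ⌊ f (elem i) ≟ 0# ⌋)

  roots-mono : ∀ {f g} → (∀ x → f x ≈ 0# → g x ≈ 0#) → roots f ≤ roots g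
  roots-mono f⇒g = count-mono q (λ i root → fromWitness (f⇒g (elem i) (toWitness root)))

  #solutions-≤-roots : ∀ {d a b f} → (∀ x → pow F x d ≈ a * x +F b → f x ≈ 0#) →
                       #solutions F d a b ≤ roots f
  #solutions-≤-roots sol⇒root = count-mono q (λ i sol → fromWitness (sol⇒root (elem i) (toWitness sol)))

  -- Poly n c f: the function f agrees pointwise with a polynomial of formal degree n,
  -- given in Horner form, whose coefficient of x^n is c.
  data Poly : ℕ → Carrier → (Carrier → Carrier) → Set where
    constant : ∀ {c f} → (∀ x → f x ≈ c) → Poly 0 c f
    horner   : ∀ {n c f g} a → Poly n c g → (∀ x → f x ≈ a +F x * g x) → Poly (suc n) c f

  poly-cong : ∀ {n c c′ f f′} → (∀ x → f x ≈ f′ x) → c ≈ c′ → Poly n c f → Poly n c′ f′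
  poly-cong f≈f′ c≈c′ (constant f≈c) = constant (λ x → trans (sym (f≈f′ x)) (trans (f≈c x) c≈c′))
  poly-cong f≈f′ c≈c′ (horner a P f≈) =
    horner a (poly-cong (λ _ → refl) c≈c′ P) (λ x → trans (sym (f≈f′ x)) (f≈ x))

  poly-shift : ∀ {n c f} → Poly n c f → Poly (suc n) 0# f
  poly-shift (constant {c} f≈c) = horner c (constant (λ _ → refl))
    (λ x → trans (f≈c x) (solve 2 (λ c x → c := c :+ x :* con 0) refl c x))
  poly-shift (horner a P f≈) = horner a (poly-shift P) f≈

  poly-raise : ∀ {k n c f} → k < n → Poly k c f → Poly n 0# f
  poly-raise k<n = go (≤⇒≤′ k<n)
    where
    go : ∀ {k n c f} → suc k ≤′ n → Poly k c f → Poly n 0# f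
    go (≤′-reflexive ≡.refl) P = poly-shift P
    go (≤′-step k<′n)        P = poly-shift (go k<′n P)

  poly-+ : ∀ {n a b f g} → Poly n a f → Poly n b g → Poly n (a +F b) (λ x → f x +F g x)
  poly-+ (constant f≈a) (constant g≈b) = constant (λ x → +-cong (f≈a x) (g≈b x))
  poly-+ {f = f} {g} (horner {g = f′} a P f≈) (horner {g = g′} b Q g≈) =
    horner (a +F b) (poly-+ P Q) (λ x → begin
      f x +F g x                           ≈⟨ +-cong (f≈ x) (g≈ x) ⟩
      (a +F x * f′ x) +F (b +F x * g′ x)   ≈⟨ solve 5 (λ a b x u v →
                                                (a :+ x :* u) :+ (b :+ x :* v) := (a :+ b) :+ x :* (u :+ v))
                                                refl a b x (f′ x) (g′ x) ⟩
      (a +F b) +F x * (f′ x +F g′ x)       ∎)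

  poly-scale : ∀ {n c f} r → Poly n c f → Poly n (r * c) (λ x → r * f x)
  poly-scale r (constant f≈c) = constant (λ x → *-congˡ (f≈c x))
  poly-scale {f = f} r (horner {g = g} a P f≈) = horner (r * a) (poly-scale r P) (λ x → begin
    r * f x                 ≈⟨ *-congˡ (f≈ x) ⟩
    r * (a +F x * g x)      ≈⟨ solve 4 (λ r a x u → r :* (a :+ x :* u) := r :* a :+ x :* (r :* u))
                                 refl r a x (g x) ⟩
    r * a +F x * (r * g x)  ∎)

  poly-monomial : ∀ c n → Poly n c (λ x → c * pow F x n)
  poly-monomial c zero    = constant (λ _ → *-identityʳ c)
  poly-monomial c (suc n) = horner 0# (poly-monomial c n)
    (λ x → solve 3 (λ c x p → c :* (x :* p) := con 0 :+ x :* (c :* p)) refl c x (pow F x n))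

  poly-+-lower : ∀ {k n a b f g} → k < n → Poly n a f → Poly k b g → Poly n a (λ x → f x +F g x)
  poly-+-lower k<n P Q = poly-cong (λ _ → refl) (+-identityʳ _) (poly-+ P (poly-raise k<n Q))

  -- f x - f r = (x - r) * h x, with both sides moved so that no subtraction occurs.
  factor-theorem : ∀ {n c f} → Poly (suc n) c f → ∀ r →
    Σ (Carrier → Carrier) λ h → Poly n c h × (∀ x → f x +F r * h x ≈ f r +F x * h x)
  factor-theorem {f = f} (horner {g = g} a (constant g≈c) f≈) r = g , constant g≈c , λ x → begin
    f x +F r * g x              ≈⟨ +-congʳ (f≈ x) ⟩
    (a +F x * g x) +F r * g x   ≈⟨ +-congˡ (*-congˡ (trans (g≈c x) (sym (g≈c r)))) ⟩
    (a +F x * g x) +F r * g r   ≈⟨ solve 5 (λ a x r u v → (a :+ x :* u) :+ r :* v := (a :+ r :* v) :+ x :* u)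
                                     refl a x r (g x) (g r) ⟩
    (a +F r * g r) +F x * g x   ≈⟨ +-congʳ (f≈ r) ⟨
    f r +F x * g x              ∎
  factor-theorem {f = f} (horner {g = g} a P@(horner _ _ _) f≈) r with factor-theorem P r
  ... | k , Pk , g-split = h , poly-+-lower (n<1+n _) P (poly-scale r Pk) , λ x → begin
    f x +F r * h x                          ≈⟨ +-cong (f≈ x) (*-congˡ (g-split x)) ⟩
    (a +F x * g x) +F r * (g r +F x * k x)  ≈⟨ solve 6 (λ a x r u v w →
                                                 (a :+ x :* u) :+ r :* (v :+ x :* w) := (a :+ r :* v) :+ x :* (u :+ r :* w))
                                                 refl a x r (g x) (g r) (k x) ⟩
    (a +F r * g r) +F x * h x               ≈⟨ +-congʳ (f≈ r) ⟨
    f r +F x * h x                          ∎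
    where
    h : Carrier → Carrier
    h x = g x +F r * k x

  roots-≤-degree : ∀ {n c f} → Poly n c f → c ≉ 0# → roots f ≤ n
  roots-≤-degree (constant f≈c) c≉0 =
    ≤-reflexive (count-none q (λ i fi≈0 → c≉0 (trans (sym (f≈c _)) (toWitness fi≈0))))
  roots-≤-degree {f = f} P@(horner _ _ _) c≉0 with any? (λ i → f (elem i) ≟ 0#)
  ... | no noRoot = ≤-trans (≤-reflexive (count-none q (λ i fi≈0 → noRoot (i , toWitness fi≈0)))) z≤n
  ... | yes (j , fj≈0) with factor-theorem P (elem j)
  ...   | h , Ph , f-split =
    ≤-trans (count-≤-suc q j root⇒j∨root-of-h) (s≤s (roots-≤-degree Ph c≉0))
    where
    root⇒j∨root-of-h : ∀ i → T ⌊ f (elem i) ≟ 0# ⌋ → i ≡ j ⊎ T ⌊ h (elem i) ≟ 0# ⌋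
    root⇒j∨root-of-h i fi≈0 with h (elem i) ≟ 0#
    ... | yes _    = inj₂ tt
    ... | no hi≉0 = inj₁ (elem-inj i j (*-cancelʳ _ _ hi≉0 (begin
      elem i * h (elem i)                   ≈⟨ +-identityˡ _ ⟨
      0# +F elem i * h (elem i)             ≈⟨ +-congʳ fj≈0 ⟨
      f (elem j) +F elem i * h (elem i)     ≈⟨ f-split (elem i) ⟨
      f (elem i) +F elem j * h (elem i)     ≈⟨ +-congʳ (toWitness fi≈0) ⟩
      0# +F elem j * h (elem i)             ≈⟨ +-identityˡ _ ⟩
      elem j * h (elem i)                   ∎)))

  binomial-roots : ∀ i {b c} f → 0 < i → ¬ (b ≈ 0# × c ≈ 0#) →
    (∀ x → f x ≈ b * pow F x i +F c) → roots f ≤ i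
  binomial-roots i {b} {c} f 0<i bc≉0 f≈ with b ≟ 0#
  ... | no b≉0  = roots-≤-degree
    (poly-cong (sym ∘ f≈) refl (poly-+-lower 0<i (poly-monomial b i) (constant (λ _ → refl))))
    b≉0
  ... | yes b≈0 = ≤-trans
    (roots-≤-degree (constant (λ x → trans (f≈ x) (drop-zero-termˡ b≈0))) (λ c≈0 → bc≉0 (b≈0 , c≈0)))
    z≤n

  trinomial-roots : ∀ i j {a b c} f → 0 < i → i < j → NonZeroVec F a b c →
    (∀ x → f x ≈ (a * pow F x j +F b * pow F x i) +F c) → roots f ≤ j
  trinomial-roots i j {a} {b} {c} f 0<i i<j abc≉0 f≈ with a ≟ 0#
  ... | no a≉0  = roots-≤-degree
    (poly-cong (sym ∘ f≈) refl (poly-+-lower (<-trans 0<i i<j)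
      (poly-+-lower i<j (poly-monomial a j) (poly-monomial b i)) (constant (λ _ → refl))))
    a≉0
  ... | yes a≈0 = ≤-trans
    (binomial-roots i f 0<i (λ (b≈0 , c≈0) → abc≉0 (a≈0 , b≈0 , c≈0))
      (λ x → trans (f≈ x) (+-congʳ (drop-zero-termˡ a≈0))))
    (<⇒≤ i<j)

module Fermat {n : ℕ} (F : FiniteField (suc n)) where
  open FiniteField F renaming (_+_ to _+F_) hiding (zero)
  open FieldProperties F
  open import Relation.Binary.Reasoning.Setoid setoid
  open import Algebra.Properties.CommutativeMonoid.Sum *-commutativeMonoid
    using () renaming (sum to product; sum-cong-≋ to product-cong; sum-permute to product-permute;
                       ∑-distrib-+ to product-distrib-*)

  nonzero : Fin n → Carrier
  nonzero j = elem (punchIn (index 0#) j)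

  nonzero-≉0 : ∀ j → nonzero j ≉ 0#
  nonzero-≉0 j j≈0 = punchInᵢ≢i (index 0#) j (elem-inj _ _ (trans j≈0 (sym (elem-index 0#))))

  product-≉0 : ∀ {m} (f : Fin m → Carrier) → (∀ i → f i ≉ 0#) → product f ≉ 0#
  product-≉0 {zero}  f f≉0 1≈0 = 0≉1 (sym 1≈0)
  product-≉0 {suc m} f f≉0     = *-≉0 (f≉0 zero) (product-≉0 (f ∘ suc) (f≉0 ∘ suc))

  product-const : ∀ m x → product {m} (λ _ → x) ≈ pow F x m
  product-const zero    x = refl
  product-const (suc m) x = *-congˡ (product-const m x)

  index-*-inverse : ∀ {x y} → x * y ≈ 1# → ∀ i → index (x * elem (index (y * elem i))) ≡ i
  index-*-inverse {x} {y} xy≈1 i = elem-inj _ _ (begin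
    elem (index (x * elem (index (y * elem i))))  ≈⟨ elem-index _ ⟩
    x * elem (index (y * elem i))                 ≈⟨ *-congˡ (elem-index _) ⟩
    x * (y * elem i)                              ≈⟨ *-assoc x y _ ⟨
    (x * y) * elem i                              ≈⟨ *-congʳ xy≈1 ⟩
    1# * elem i                                   ≈⟨ *-identityˡ _ ⟩
    elem i                                        ∎)

  scaling : ∀ x → x ≉ 0# → Permutation′ (suc n)
  scaling x x≉0 = permutation (λ i → index (x * elem i)) (λ i → index (x⁻¹ * elem i))
    (index-*-inverse xx⁻¹≈1) (index-*-inverse (trans (*-comm x⁻¹ x) xx⁻¹≈1))
    where
    x⁻¹ : Carrier
    x⁻¹ = proj₁ (inverse x x≉0)
    xx⁻¹≈1 : x * x⁻¹ ≈ 1#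
    xx⁻¹≈1 = proj₂ (inverse x x≉0)

  scaling-fixes-0 : ∀ x x≉0 → scaling x x≉0 ⟨$⟩ʳ index 0# ≡ index 0#
  scaling-fixes-0 x x≉0 = elem-inj _ _ (begin
    elem (index (x * elem (index 0#)))   ≈⟨ elem-index _ ⟩
    x * elem (index 0#)                  ≈⟨ *-congˡ (elem-index 0#) ⟩
    x * 0#                               ≈⟨ zeroʳ x ⟩
    0#                                   ≈⟨ elem-index 0# ⟨
    elem (index 0#)                      ∎)

  fermat : ∀ x → x ≉ 0# → pow F x n ≈ 1#
  fermat x x≉0 = *-cancelʳ _ _ (product-≉0 nonzero nonzero-≉0) (begin
    pow F x n * product nonzero              ≈⟨ *-congʳ (product-const n x) ⟨
    product {n} (λ _ → x) * product nonzero  ≈⟨ product-distrib-* (λ _ → x) nonzero ⟨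
    product (λ j → x * nonzero j)            ≈⟨ product-cong scale-nonzero ⟩
    product (λ j → nonzero (π ⟨$⟩ʳ j))       ≈⟨ product-permute nonzero π ⟨
    product nonzero                          ≈⟨ *-identityˡ _ ⟨
    1# * product nonzero                     ∎)
    where
    σ : Permutation′ (suc n)
    σ = scaling x x≉0
    π : Permutation′ n
    π = remove (index 0#) σ
    scale-nonzero : ∀ j → x * nonzero j ≈ nonzero (π ⟨$⟩ʳ j)
    scale-nonzero j = begin
      x * nonzero j                                ≈⟨ elem-index _ ⟨
      elem (σ ⟨$⟩ʳ punchIn (index 0#) j)           ≡⟨ ≡.cong elem (punchIn-remove σ (index 0#) j) ⟩
      elem (punchIn (σ ⟨$⟩ʳ index 0#) (π ⟨$⟩ʳ j))  ≡⟨ ≡.cong (λ k → elem (punchIn k (π ⟨$⟩ʳ j))) (scaling-fixes-0 x x≉0) ⟩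
      nonzero (π ⟨$⟩ʳ j)                           ∎

module LinesOnCurve {n : ℕ} (F : FiniteField (suc n)) {m d : ℕ} (n≡m+d : n ≡ m + d) where
  open FiniteField F renaming (_+_ to _+F_) hiding (zero)
  open FieldProperties F
  open PolynomialFunctions F
  open Fermat F using (fermat)
  open import Relation.Binary.Reasoning.Setoid setoid
  open import Algebra.Solver.Ring.NaturalCoefficients.Default commutativeSemiring
    using (solve; _:=_; _:+_; _:*_; con)

  lineEq : Carrier → Carrier → Carrier → Carrier → Carrier
  lineEq l0 l1 l2 x = ((l0 * x) +F (l1 * pow F x d)) +F l2

  -- For x ≉ 0 this is x^m * lineEq l0 l1 l2 x, because x^(m+d) = x^(q-1) = 1.
  lineEq′ : Carrier → Carrier → Carrier → Carrier → Carrier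
  lineEq′ l0 l1 l2 x = ((l0 * pow F x (suc m)) +F (l2 * pow F x m)) +F l1

  x^m*x^d≈1 : ∀ {x} → x ≉ 0# → pow F x m * pow F x d ≈ 1#
  x^m*x^d≈1 {x} x≉0 = trans (sym (pow-+ x m d)) (≡.subst (λ k → pow F x k ≈ 1#) n≡m+d (fermat x x≉0))

  lineEq-root⇒lineEq′-root : ∀ {l0 l1 l2 x} → x ≉ 0# → lineEq l0 l1 l2 x ≈ 0# → lineEq′ l0 l1 l2 x ≈ 0#
  lineEq-root⇒lineEq′-root {l0} {l1} {l2} {x} x≉0 root = begin
    ((l0 * (x * xᵐ)) +F (l2 * xᵐ)) +F l1              ≈⟨ +-congˡ (*-identityʳ l1) ⟨
    ((l0 * (x * xᵐ)) +F (l2 * xᵐ)) +F l1 * 1#         ≈⟨ +-congˡ (*-congˡ (x^m*x^d≈1 x≉0)) ⟨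
    ((l0 * (x * xᵐ)) +F (l2 * xᵐ)) +F l1 * (xᵐ * xᵈ)  ≈⟨ solve 6 (λ l0 l1 l2 x xᵐ xᵈ →
        ((l0 :* (x :* xᵐ)) :+ (l2 :* xᵐ)) :+ l1 :* (xᵐ :* xᵈ) := xᵐ :* (((l0 :* x) :+ (l1 :* xᵈ)) :+ l2))
        refl l0 l1 l2 x xᵐ xᵈ ⟩
    xᵐ * lineEq l0 l1 l2 x                            ≈⟨ *-congˡ root ⟩
    xᵐ * 0#                                           ≈⟨ zeroʳ xᵐ ⟩
    0#                                                ∎
    where
    xᵐ xᵈ : Carrier
    xᵐ = pow F x m
    xᵈ = pow F x d

  lineEq-at-0 : 0 < d → ∀ {l0 l1 l2 x} → x ≈ 0# → lineEq l0 l1 l2 x ≈ l2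
  lineEq-at-0 0<d {l0} {l1} {l2} {x} x≈0 = begin
    ((l0 * x) +F (l1 * pow F x d)) +F l2  ≈⟨ +-congʳ (+-cong (*-congˡ x≈0) (*-congˡ (pow-≈0 d 0<d x≈0))) ⟩
    ((l0 * 0#) +F (l1 * 0#)) +F l2        ≈⟨ solve 3 (λ l0 l1 l2 → ((l0 :* con 0) :+ (l1 :* con 0)) :+ l2 := l2)
                                               refl l0 l1 l2 ⟩
    l2                                    ∎

  roots-lineEq-≤-1+roots-lineEq′ : ∀ l0 l1 l2 → roots (lineEq l0 l1 l2) ≤ suc (roots (lineEq′ l0 l1 l2))
  roots-lineEq-≤-1+roots-lineEq′ l0 l1 l2 = count-≤-suc (suc n) (index 0#) root⇒0∨root′
    where
    root⇒0∨root′ : ∀ i → T ⌊ lineEq l0 l1 l2 (elem i) ≟ 0# ⌋ →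
                   i ≡ index 0# ⊎ T ⌊ lineEq′ l0 l1 l2 (elem i) ≟ 0# ⌋
    root⇒0∨root′ i root with elem i ≟ 0#
    ... | yes i≈0 = inj₁ (elem-inj _ _ (trans i≈0 (sym (elem-index 0#))))
    ... | no i≉0  = inj₂ (fromWitness (lineEq-root⇒lineEq′-root i≉0 (toWitness root)))

  roots-lineEq-≤-roots-lineEq′ : 0 < d → ∀ l0 l1 l2 → l2 ≉ 0# →
                                 roots (lineEq l0 l1 l2) ≤ roots (lineEq′ l0 l1 l2)
  roots-lineEq-≤-roots-lineEq′ 0<d l0 l1 l2 l2≉0 = roots-mono root⇒root′
    where
    root⇒root′ : ∀ x → lineEq l0 l1 l2 x ≈ 0# → lineEq′ l0 l1 l2 x ≈ 0#
    root⇒root′ x root with x ≟ 0#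
    ... | no x≉0  = lineEq-root⇒lineEq′-root x≉0 root
    ... | yes x≈0 = ⊥-elim (l2≉0 (trans (sym (lineEq-at-0 0<d x≈0)) root))

  roots-lineEq-≤-d : 1 < d → ∀ {l0 l1 l2} → l1 ≉ 0# → roots (lineEq l0 l1 l2) ≤ d
  roots-lineEq-≤-d 1<d {l0} {l1} {l2} l1≉0 =
    trinomial-roots 1 d (lineEq l0 l1 l2) (s≤s z≤n) 1<d (λ (l1≈0 , _) → l1≉0 l1≈0) (λ x → +-congʳ (begin
      l0 * x +F l1 * pow F x d          ≈⟨ +-comm _ _ ⟩
      l1 * pow F x d +F l0 * x          ≈⟨ +-congˡ (*-congˡ (*-identityʳ x)) ⟨
      l1 * pow F x d +F l0 * pow F x 1  ∎))

  roots-lineEq-≤-1 : ∀ {l0 l1 l2} → NonZeroVec F l0 l1 l2 → l1 ≈ 0# → roots (lineEq l0 l1 l2) ≤ 1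
  roots-lineEq-≤-1 {l0} {l1} {l2} l≉0 l1≈0 =
    binomial-roots 1 (lineEq l0 l1 l2) (s≤s z≤n) (λ (l0≈0 , l2≈0) → l≉0 (l0≈0 , l1≈0 , l2≈0))
      (λ x → +-congʳ (trans (drop-zero-termʳ l1≈0) (*-congˡ (sym (*-identityʳ x)))))

  roots-lineEq′-≤-1+m : 0 < m → ∀ {l0 l1 l2} → l1 ≉ 0# → roots (lineEq′ l0 l1 l2) ≤ suc m
  roots-lineEq′-≤-1+m 0<m {l0} {l1} {l2} l1≉0 =
    trinomial-roots m (suc m) (lineEq′ l0 l1 l2) 0<m (n<1+n m) (λ (_ , _ , l1≈0) → l1≉0 l1≈0) (λ _ → refl)

  roots-lineEq′-≤-m : 0 < m → ∀ {l0 l1 l2} → l0 ≈ 0# → l2 ≉ 0# → roots (lineEq′ l0 l1 l2) ≤ m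
  roots-lineEq′-≤-m 0<m {l0} {l1} {l2} l0≈0 l2≉0 =
    binomial-roots m (lineEq′ l0 l1 l2) 0<m (λ (l2≈0 , _) → l2≉0 l2≈0) (λ _ → +-congʳ (drop-zero-termˡ l0≈0))

  lineMeetsSf-≤ : 1 < d → 0 < m → ∀ l0 l1 l2 → NonZeroVec F l0 l1 l2 →
                  roots (lineEq l0 l1 l2) + (if ⌊ l1 ≟ 0# ⌋ then 1 else 0) ≤ d ⊓ (suc m + 1)
  lineMeetsSf-≤ 1<d 0<m l0 l1 l2 l≉0 with l1 ≟ 0#
  ... | no l1≉0 = ≤-trans (≤-reflexive (ℕₚ.+-identityʳ _)) (⊓-glb
    (roots-lineEq-≤-d 1<d l1≉0)
    (≤-trans (roots-lineEq-≤-1+roots-lineEq′ l0 l1 l2)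
      (≤-trans (s≤s (roots-lineEq′-≤-1+m 0<m l1≉0)) (≤-reflexive (ℕₚ.+-comm 1 (suc m))))))
  ... | yes l1≈0 =
    ≤-trans (+-mono-≤ (roots-lineEq-≤-1 l≉0 l1≈0) ≤-refl) (⊓-glb 1<d (s≤s (m≤n+m 1 m)))

  #solutions-≤-roots-lineEq : ∀ a b → #solutions F d a b ≤ roots (lineEq (- a) 1# (- b))
  #solutions-≤-roots-lineEq a b = #solutions-≤-roots {d = d} solution⇒root
    where
    solution⇒root : ∀ x → pow F x d ≈ a * x +F b → lineEq (- a) 1# (- b) x ≈ 0#
    solution⇒root x sol = begin
      ((- a) * x +F 1# * pow F x d) +F (- b)     ≈⟨ +-congʳ (+-congˡ (*-congˡ sol)) ⟩
      ((- a) * x +F 1# * (a * x +F b)) +F (- b)  ≈⟨ solve 5 (λ a⁻ a x b b⁻ →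
          (a⁻ :* x :+ con 1 :* (a :* x :+ b)) :+ b⁻ := (a⁻ :+ a) :* x :+ (b :+ b⁻))
          refl (- a) a x b (- b) ⟩
      ((- a) +F a) * x +F (b +F (- b))           ≈⟨ +-cong (*-congʳ (-‿inverseˡ a)) (-‿inverseʳ b) ⟩
      0# * x +F 0#                               ≈⟨ drop-zero-termˡ refl ⟩
      0#                                         ∎

  #solutions-≤ : 0 < m → ∀ a b → #solutions F d a b ≤ suc m + 1
  #solutions-≤ 0<m a b =
    ≤-trans (#solutions-≤-roots-lineEq a b)
      (≤-trans (roots-lineEq-≤-1+roots-lineEq′ (- a) 1# (- b))
        (≤-trans (s≤s (roots-lineEq′-≤-1+m 0<m 1≉0)) (≤-reflexive (ℕₚ.+-comm 1 (suc m)))))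

  #solutions-≤-b≉0 : 0 < d → 0 < m → ∀ a {b} → b ≉ 0# → #solutions F d a b ≤ suc m
  #solutions-≤-b≉0 0<d 0<m a {b} b≉0 =
    ≤-trans (#solutions-≤-roots-lineEq a b)
      (≤-trans (roots-lineEq-≤-roots-lineEq′ 0<d (- a) 1# (- b) (-‿≉0 b≉0))
        (roots-lineEq′-≤-1+m 0<m 1≉0))

  #solutions-≤-a≈0-b≉0 : 0 < d → 0 < m → ∀ {a b} → a ≈ 0# → b ≉ 0# → #solutions F d a b ≤ m
  #solutions-≤-a≈0-b≉0 0<d 0<m {a} {b} a≈0 b≉0 =
    ≤-trans (#solutions-≤-roots-lineEq a b)
      (≤-trans (roots-lineEq-≤-roots-lineEq′ 0<d (- a) 1# (- b) (-‿≉0 b≉0))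
        (roots-lineEq′-≤-m 0<m (-‿≈0 a≈0) (-‿≉0 b≉0)))

theorem3p2 : (q : ℕ) (F : FiniteField q) (d : ℕ) → 2 < d → d < q ∸ 1 →
    degSf≤ F d (d ⊓ ((q ∸ d) + 1))
    × (∀ a b → ¬ IsZero F a → IsZero F b → #solutions F d a b ≤ (q ∸ d) + 1)
    × (∀ a b → ¬ IsZero F a → ¬ IsZero F b → #solutions F d a b ≤ q ∸ d)
    × (∀ a b → IsZero F a → ¬ IsZero F b → #solutions F d a b ≤ (q ∸ d) ∸ 1)
theorem3p2 zero    F d 2<d ()
theorem3p2 (suc n) F d 2<d d<n rewrite ℕₚ.+-∸-assoc 1 (<⇒≤ d<n) =
    lineMeetsSf-≤ 1<d 0<m
  , (λ a b _ _ → #solutions-≤ 0<m a b)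
  , (λ a b _ b≉0 → #solutions-≤-b≉0 0<d 0<m a b≉0)
  , (λ a b a≈0 b≉0 → #solutions-≤-a≈0-b≉0 0<d 0<m a≈0 b≉0)
  where
  open LinesOnCurve F {n ∸ d} {d} (≡.sym (ℕₚ.m∸n+n≡m (<⇒≤ d<n)))
  1<d : 1 < d
  1<d = <⇒≤ 2<d
  0<d : 0 < d
  0<d = ≤-trans (s≤s z≤n) 2<d
  0<m : 0 < n ∸ d
  0<m = ℕₚ.m<n⇒0<n∸m d<n
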